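{- Let $G$ be a (claw, co-claw)-free graph. If $G$ does not contain a net, a 3-sun, or an antenna as an induced subgraph, and $G$ contains a bull as an induced subgraph, then $G$ is (isomorphic to) an induced subgraph of the graph $F_2$.
   Context: Graphs are finite and simple. The claw is $K_{1,3}$; the co-claw is its complement (a triangle plus an isolated vertex). $G$ is $H$-free if it contains no member of $H$ as an induced subgraph. The net is the graph on 6 vertices consisting of a triangle $c_1c_2c_3$ and three further vertices $s_1,s_2,s_3$ with $s_i$ adjacent only to $c_i$. The 3-sun is the complement of the net. The bull is the graph on 5 vertices consisting of a triangle with two pendant edges attached at two distinct triangle vertices. The antenna is the graph on vertices $a,b,c,d,e,f$ with edges $ab, bc, cd, da, eb, ec, fe$. $F_2$ is the graph on vertices $c_1,c_2,c_3,s_1,s_2,x,y$ with the 11 edges $c_1c_2, c_1c_3, c_2c_3, s_1c_1, s_2c_2, xs_1, xc_1, xs_2, ys_1, yc_2, ys_2$ (a bull on $c_1,c_2,c_3,s_1,s_2$ together with $x$ adjacent to exactly $s_1,c_1,s_2$ and $y$ adjacent to exactly $s_1,c_2,s_2$). -}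

module Defs where

open import Data.Nat using (ℕ; suc)
open import Data.Fin using (Fin; zero; suc)
open import Data.Bool using (Bool; true; false; _∨_)
open import Data.Product using (Σ; _×_; ∃-syntax)
open import Relation.Binary.PropositionalEquality using (_≡_; cong) renaming (sym to ≡-sym)
open import Data.Fin using (_≟_)
open import Data.Bool using (if_then_else_; not)
open import Relation.Nullary using (does; yes; no)
open import Data.Empty using (⊥-elim)
open import Relation.Nullary using (¬_)
open import Function.Definitions using (Injective)

record Graph : Set where
  field
    n     : ℕ
    adj   : Fin n → Fin n → Bool
    sym   : ∀ x y → adj x y ≡ adj y x
    irrefl : ∀ x → adj x x ≡ false
open Graph public

record InducedEmbedding (H G : Graph) : Set where
  field
    f        : Fin (n H) → Fin (n G)
    f-inj    : Injective _≡_ _≡_ f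
    f-adj    : ∀ x y → adj G (f x) (f y) ≡ adj H x y

Contains : Graph → Graph → Set
Contains G H = InducedEmbedding H G

Free : Graph → Graph → Set
Free G H = ¬ Contains G H

-- Explicit graphs: "e" lists each edge in one direction, and
-- adj x y = e x y ∨ e y x (so adjacency is symmetric); diagonal must be false.

module _ where
  private
    ∨-comm : ∀ a b → (a ∨ b) ≡ (b ∨ a)
    ∨-comm false false = _≡_.refl
    ∨-comm false true  = _≡_.refl
    ∨-comm true  false = _≡_.refl
    ∨-comm true  true  = _≡_.refl

  mkGraph : (k : ℕ) (e : Fin k → Fin k → Bool) →
            (∀ x → (e x x ∨ e x x) ≡ false) → Graph
  mkGraph k e irr = record
    { n = k ; adj = λ x y → e x y ∨ e y x
    ; sym = λ x y → ∨-comm (e x y) (e y x) ; irrefl = irr }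


claw-e : Fin 4 → Fin 4 → Bool
claw-e zero (suc zero) = true
claw-e zero (suc (suc zero)) = true
claw-e zero (suc (suc (suc zero))) = true
claw-e _ _ = false

claw : Graph
claw = mkGraph 4 claw-e irr
  where
  irr : ∀ x → (claw-e x x ∨ claw-e x x) ≡ false
  irr zero = _≡_.refl
  irr (suc zero) = _≡_.refl
  irr (suc (suc zero)) = _≡_.refl
  irr (suc (suc (suc zero))) = _≡_.refl

coClaw-e : Fin 4 → Fin 4 → Bool
coClaw-e zero (suc zero) = true
coClaw-e zero (suc (suc zero)) = true
coClaw-e (suc zero) (suc (suc zero)) = true
coClaw-e _ _ = false

coClaw : Graph
coClaw = mkGraph 4 coClaw-e irr
  where
  irr : ∀ x → (coClaw-e x x ∨ coClaw-e x x) ≡ false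
  irr zero = _≡_.refl
  irr (suc zero) = _≡_.refl
  irr (suc (suc zero)) = _≡_.refl
  irr (suc (suc (suc zero))) = _≡_.refl

-- net: triangle c1=0,c2=1,c3=2; s1=3,s2=4,s3=5 with s_i adjacent only to c_i
net-e : Fin 6 → Fin 6 → Bool
net-e zero (suc zero) = true
net-e zero (suc (suc zero)) = true
net-e (suc zero) (suc (suc zero)) = true
net-e (suc (suc (suc zero))) zero = true
net-e (suc (suc (suc (suc zero)))) (suc zero) = true
net-e (suc (suc (suc (suc (suc zero))))) (suc (suc zero)) = true
net-e _ _ = false

net : Graph
net = mkGraph 6 net-e irr
  where
  irr : ∀ x → (net-e x x ∨ net-e x x) ≡ false
  irr zero = _≡_.refl
  irr (suc zero) = _≡_.refl
  irr (suc (suc zero)) = _≡_.refl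
  irr (suc (suc (suc zero))) = _≡_.refl
  irr (suc (suc (suc (suc zero)))) = _≡_.refl
  irr (suc (suc (suc (suc (suc zero))))) = _≡_.refl

-- bull: triangle 0,1,2; pendant 3 at 0, pendant 4 at 1
bull-e : Fin 5 → Fin 5 → Bool
bull-e zero (suc zero) = true
bull-e zero (suc (suc zero)) = true
bull-e (suc zero) (suc (suc zero)) = true
bull-e (suc (suc (suc zero))) zero = true
bull-e (suc (suc (suc (suc zero)))) (suc zero) = true
bull-e _ _ = false

bull : Graph
bull = mkGraph 5 bull-e irr
  where
  irr : ∀ x → (bull-e x x ∨ bull-e x x) ≡ false
  irr zero = _≡_.refl
  irr (suc zero) = _≡_.refl
  irr (suc (suc zero)) = _≡_.refl
  irr (suc (suc (suc zero))) = _≡_.refl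
  irr (suc (suc (suc (suc zero)))) = _≡_.refl

-- antenna: a=0,b=1,c=2,d=3,e=4,f=5; edges ab,bc,cd,da,eb,ec,fe
antenna-e : Fin 6 → Fin 6 → Bool
antenna-e zero (suc zero) = true
antenna-e (suc zero) (suc (suc zero)) = true
antenna-e (suc (suc zero)) (suc (suc (suc zero))) = true
antenna-e (suc (suc (suc zero))) zero = true
antenna-e (suc (suc (suc (suc zero)))) (suc zero) = true
antenna-e (suc (suc (suc (suc zero)))) (suc (suc zero)) = true
antenna-e (suc (suc (suc (suc (suc zero))))) (suc (suc (suc (suc zero)))) = true
antenna-e _ _ = false

antenna : Graph
antenna = mkGraph 6 antenna-e irr
  where
  irr : ∀ x → (antenna-e x x ∨ antenna-e x x) ≡ false
  irr zero = _≡_.refl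
  irr (suc zero) = _≡_.refl
  irr (suc (suc zero)) = _≡_.refl
  irr (suc (suc (suc zero))) = _≡_.refl
  irr (suc (suc (suc (suc zero)))) = _≡_.refl
  irr (suc (suc (suc (suc (suc zero))))) = _≡_.refl

-- F2: c1=0,c2=1,c3=2,s1=3,s2=4,x=5,y=6
F₂-e : Fin 7 → Fin 7 → Bool
F₂-e zero (suc zero) = true
F₂-e zero (suc (suc zero)) = true
F₂-e (suc zero) (suc (suc zero)) = true
F₂-e (suc (suc (suc zero))) zero = true
F₂-e (suc (suc (suc (suc zero)))) (suc zero) = true
F₂-e (suc (suc (suc (suc (suc zero))))) (suc (suc (suc zero))) = true
F₂-e (suc (suc (suc (suc (suc zero))))) zero = true
F₂-e (suc (suc (suc (suc (suc zero))))) (suc (suc (suc (suc zero)))) = true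
F₂-e (suc (suc (suc (suc (suc (suc zero)))))) (suc (suc (suc zero))) = true
F₂-e (suc (suc (suc (suc (suc (suc zero)))))) (suc zero) = true
F₂-e (suc (suc (suc (suc (suc (suc zero)))))) (suc (suc (suc (suc zero)))) = true
F₂-e _ _ = false

F₂ : Graph
F₂ = mkGraph 7 F₂-e irr
  where
  irr : ∀ x → (F₂-e x x ∨ F₂-e x x) ≡ false
  irr zero = _≡_.refl
  irr (suc zero) = _≡_.refl
  irr (suc (suc zero)) = _≡_.refl
  irr (suc (suc (suc zero))) = _≡_.refl
  irr (suc (suc (suc (suc zero)))) = _≡_.refl
  irr (suc (suc (suc (suc (suc zero))))) = _≡_.refl
  irr (suc (suc (suc (suc (suc (suc zero)))))) = _≡_.refl

complement : Graph → Graph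
complement G = record
  { n = n G
  ; adj = λ x y → if does (x ≟ y) then false else not (adj G x y)
  ; sym = λ x y → symC x y
  ; irrefl = λ x → irrC x }
  where
  symC : ∀ x y → (if does (x ≟ y) then false else not (adj G x y))
                 ≡ (if does (y ≟ x) then false else not (adj G y x))
  symC x y with x ≟ y | y ≟ x
  ... | yes _ | yes _ = _≡_.refl
  ... | yes p | no q = ⊥-elim (q (≡-sym p))
  ... | no p | yes q = ⊥-elim (p (≡-sym q))
  ... | no _ | no _ = cong not (Graph.sym G x y)
  irrC : ∀ x → (if does (x ≟ x) then false else not (adj G x x)) ≡ false
  irrC x with x ≟ x
  ... | yes _ = _≡_.refl
  ... | no p = ⊥-elim (p _≡_.refl)

sun3 : Graph
sun3 = complement net

-- Fix an induced bull c₁c₂c₃s₁s₂ in G. A vertex v outside it is constrained by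
-- the forbidden subgraphs on the six vertices bull + v: of the 32 possible
-- neighbourhoods of v in the bull, every one except {c₁,s₁,s₂} (the vertex x of
-- F₂) and {c₂,s₁,s₂} (the vertex y) yields a claw, co-claw, net, 3-sun or
-- antenna. Two distinct outside vertices v, w yield a co-claw {v,w,s₁,c₃} when
-- adjacent, and a claw or an antenna when not. Hence G is the bull, or the bull
-- plus one vertex of type x or y, and either way an induced subgraph of F₂.
module Submission where

open import Defs hiding (sym)
open import Data.Bool using (Bool; true; false)
import Data.Bool.Properties as Bool
open import Data.Empty using (⊥-elim)
open import Data.Fin using (Fin; zero; suc; _≟_; #_)
open import Data.Fin.Properties using (all?; any?; ¬∀⟶∃¬)
open import Data.Nat using (suc)
open import Data.Product using (∃; _,_; proj₁; proj₂)
open import Data.Sum using (_⊎_; inj₁; inj₂)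
open import Data.Vec using (Vec; []; _∷_; lookup; tabulate)
open import Data.Vec.Properties using (lookup∘tabulate)
open import Relation.Nullary using (¬_; yes; no)
open import Relation.Nullary.Decidable using (True; toWitness; _→-dec_)
open import Relation.Binary.PropositionalEquality
  using (_≡_; _≢_; refl; sym; trans; cong; cong₂)

open InducedEmbedding

tabulate≡⇒≗lookup : ∀ {a} {A : Set a} {k} {g : Fin k → A} {V : Vec A k} →
  tabulate g ≡ V → ∀ i → g i ≡ lookup V i
tabulate≡⇒≗lookup {g = g} eq i = trans (sym (lookup∘tabulate g i)) (cong (λ V → lookup V i) eq)

contains-trans : ∀ {G H K} → Contains G H → Contains H K → Contains G K
contains-trans e₁ e₂ = record
  { f     = λ x → f e₁ (f e₂ x)
  ; f-inj = λ p → f-inj e₂ (f-inj e₁ p)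
  ; f-adj = λ x y → trans (f-adj e₁ (f e₂ x) (f e₂ y)) (f-adj e₂ x y)
  }

surjective-embedding-inverse : ∀ {G H} (e : InducedEmbedding H G) →
  (∀ w → ∃ λ x → f e x ≡ w) → InducedEmbedding G H
surjective-embedding-inverse {G} {H} e onto = record
  { f     = preimage
  ; f-inj = λ {w} {w′} p → trans (sym (proj₂ (onto w)))
                             (trans (cong (f e) p) (proj₂ (onto w′)))
  ; f-adj = λ w w′ → trans (sym (f-adj e (preimage w) (preimage w′)))
                       (cong₂ (adj G) (proj₂ (onto w)) (proj₂ (onto w′)))
  }
  where
  preimage : Fin (n G) → Fin (n H)
  preimage w = proj₁ (onto w)

embedding : ∀ {G H} (φ : Vec (Fin (n G)) (n H)) →
  {True (all? λ x → all? λ y → (lookup φ x ≟ lookup φ y) →-dec (x ≟ y))} →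
  {True (all? λ x → all? λ y → adj G (lookup φ x) (lookup φ y) Bool.≟ adj H x y)} →
  Contains G H
embedding φ {inj} {pres} = record
  { f     = lookup φ
  ; f-inj = λ {x} {y} → toWitness inj x y
  ; f-adj = toWitness pres
  }

-- The new vertex is zero; its neighbourhood is N.
extend : (H : Graph) → (Fin (n H) → Bool) → Graph
extend H N = record { n = suc (n H) ; adj = adj′ ; sym = sym′ ; irrefl = irrefl′ }
  where
  adj′ : Fin (suc (n H)) → Fin (suc (n H)) → Bool
  adj′ zero    zero    = false
  adj′ zero    (suc j) = N j
  adj′ (suc i) zero    = N i
  adj′ (suc i) (suc j) = adj H i j

  sym′ : ∀ x y → adj′ x y ≡ adj′ y x
  sym′ zero    zero    = refl
  sym′ zero    (suc j) = refl
  sym′ (suc i) zero    = refl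
  sym′ (suc i) (suc j) = Graph.sym H i j

  irrefl′ : ∀ x → adj′ x x ≡ false
  irrefl′ zero    = refl
  irrefl′ (suc i) = irrefl H i

extend-embedding : ∀ {G H} (e : InducedEmbedding H G) (v : Fin (n G))
  {N : Fin (n H) → Bool} → (∀ i → f e i ≢ v) →
  (∀ i → adj G v (f e i) ≡ N i) → InducedEmbedding (extend H N) G
extend-embedding {G} {H} e v v∉ nbhd = record { f = f′ ; f-inj = inj′ ; f-adj = adj′ }
  where
  f′ : Fin (suc (n H)) → Fin (n G)
  f′ zero    = v
  f′ (suc i) = f e i

  inj′ : ∀ {x y} → f′ x ≡ f′ y → x ≡ y
  inj′ {zero}  {zero}  _ = refl
  inj′ {zero}  {suc j} p = ⊥-elim (v∉ j (sym p))
  inj′ {suc i} {zero}  p = ⊥-elim (v∉ i p)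
  inj′ {suc i} {suc j} p = cong suc (f-inj e p)

  adj′ : ∀ x y → adj G (f′ x) (f′ y) ≡ adj (extend H _) x y
  adj′ zero    zero    = irrefl G v
  adj′ zero    (suc j) = nbhd j
  adj′ (suc i) zero    = trans (Graph.sym G (f e i) v) (nbhd i)
  adj′ (suc i) (suc j) = f-adj e i j

data Obstruction (H : Graph) : Set where
  has-claw    : Contains H claw    → Obstruction H
  has-coClaw  : Contains H coClaw  → Obstruction H
  has-net     : Contains H net     → Obstruction H
  has-sun3    : Contains H sun3    → Obstruction H
  has-antenna : Contains H antenna → Obstruction H

record ForbiddenFree (G : Graph) : Set where
  field
    claw-free    : Free G claw
    coClaw-free  : Free G coClaw
    net-free     : Free G net
    sun3-free    : Free G sun3
    antenna-free : Free G antenna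

obstruction-absurd : ∀ {G H} → ForbiddenFree G → Contains G H → ¬ Obstruction H
obstruction-absurd free e (has-claw o)    = ForbiddenFree.claw-free free (contains-trans e o)
obstruction-absurd free e (has-coClaw o)  = ForbiddenFree.coClaw-free free (contains-trans e o)
obstruction-absurd free e (has-net o)     = ForbiddenFree.net-free free (contains-trans e o)
obstruction-absurd free e (has-sun3 o)    = ForbiddenFree.sun3-free free (contains-trans e o)
obstruction-absurd free e (has-antenna o) = ForbiddenFree.antenna-free free (contains-trans e o)

-- Neighbourhoods in the bull are listed in the order c₁, c₂, c₃, s₁, s₂.
data Attachment : Set where
  at-c₁ at-c₂ : Attachment

neighbourhood : Attachment → Vec Bool 5
neighbourhood at-c₁ = true  ∷ false ∷ false ∷ true ∷ true ∷ []
neighbourhood at-c₂ = false ∷ true  ∷ false ∷ true ∷ true ∷ []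

bull-extension-obstruction : (N : Vec Bool 5) →
  (∃ λ a → N ≡ neighbourhood a) ⊎ Obstruction (extend bull (lookup N))
bull-extension-obstruction (true  ∷ false ∷ false ∷ true  ∷ true  ∷ []) = inj₁ (at-c₁ , refl)
bull-extension-obstruction (false ∷ true  ∷ false ∷ true  ∷ true  ∷ []) = inj₁ (at-c₂ , refl)
bull-extension-obstruction (false ∷ false ∷ false ∷ _     ∷ _     ∷ []) = inj₂ (has-coClaw (embedding (# 1 ∷ # 2 ∷ # 3 ∷ # 0 ∷ [])))
bull-extension-obstruction (false ∷ true  ∷ _     ∷ _     ∷ false ∷ []) = inj₂ (has-claw (embedding (# 2 ∷ # 0 ∷ # 1 ∷ # 5 ∷ [])))
bull-extension-obstruction (true  ∷ false ∷ _     ∷ false ∷ _     ∷ []) = inj₂ (has-claw (embedding (# 1 ∷ # 0 ∷ # 2 ∷ # 4 ∷ [])))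
bull-extension-obstruction (true  ∷ _     ∷ _     ∷ true  ∷ false ∷ []) = inj₂ (has-coClaw (embedding (# 0 ∷ # 1 ∷ # 4 ∷ # 5 ∷ [])))
bull-extension-obstruction (_     ∷ true  ∷ _     ∷ false ∷ true  ∷ []) = inj₂ (has-coClaw (embedding (# 0 ∷ # 2 ∷ # 5 ∷ # 4 ∷ [])))
bull-extension-obstruction (_     ∷ _     ∷ true  ∷ true  ∷ true  ∷ []) = inj₂ (has-claw (embedding (# 0 ∷ # 3 ∷ # 4 ∷ # 5 ∷ [])))
bull-extension-obstruction (false ∷ false ∷ true  ∷ false ∷ false ∷ []) = inj₂ (has-net (embedding (# 1 ∷ # 2 ∷ # 3 ∷ # 4 ∷ # 5 ∷ # 0 ∷ [])))
bull-extension-obstruction (false ∷ false ∷ true  ∷ false ∷ true  ∷ []) = inj₂ (has-antenna (embedding (# 0 ∷ # 3 ∷ # 2 ∷ # 5 ∷ # 1 ∷ # 4 ∷ [])))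
bull-extension-obstruction (false ∷ false ∷ true  ∷ true  ∷ false ∷ []) = inj₂ (has-antenna (embedding (# 0 ∷ # 3 ∷ # 1 ∷ # 4 ∷ # 2 ∷ # 5 ∷ [])))
bull-extension-obstruction (true  ∷ true  ∷ false ∷ false ∷ false ∷ []) = inj₂ (has-claw (embedding (# 1 ∷ # 0 ∷ # 3 ∷ # 4 ∷ [])))
bull-extension-obstruction (true  ∷ true  ∷ false ∷ true  ∷ true  ∷ []) = inj₂ (has-sun3 (embedding (# 3 ∷ # 4 ∷ # 5 ∷ # 0 ∷ # 2 ∷ # 1 ∷ [])))
bull-extension-obstruction (true  ∷ true  ∷ true  ∷ false ∷ false ∷ []) = inj₂ (has-coClaw (embedding (# 0 ∷ # 1 ∷ # 3 ∷ # 5 ∷ [])))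

-- The second new vertex is 0, the first is 1, and bull vertex i is i + 2.
two-vertex-extension-obstruction : (a a′ : Attachment) (adjacent : Bool) →
  Obstruction (extend (extend bull (lookup (neighbourhood a))) (lookup (adjacent ∷ neighbourhood a′)))
two-vertex-extension-obstruction at-c₁ at-c₁ true  = has-coClaw (embedding (# 0 ∷ # 1 ∷ # 5 ∷ # 4 ∷ []))
two-vertex-extension-obstruction at-c₁ at-c₂ true  = has-coClaw (embedding (# 0 ∷ # 1 ∷ # 5 ∷ # 4 ∷ []))
two-vertex-extension-obstruction at-c₂ at-c₁ true  = has-coClaw (embedding (# 0 ∷ # 1 ∷ # 5 ∷ # 4 ∷ []))
two-vertex-extension-obstruction at-c₂ at-c₂ true  = has-coClaw (embedding (# 0 ∷ # 1 ∷ # 5 ∷ # 4 ∷ []))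
two-vertex-extension-obstruction at-c₁ at-c₁ false = has-claw (embedding (# 2 ∷ # 0 ∷ # 1 ∷ # 3 ∷ []))
two-vertex-extension-obstruction at-c₂ at-c₂ false = has-claw (embedding (# 3 ∷ # 0 ∷ # 1 ∷ # 2 ∷ []))
two-vertex-extension-obstruction at-c₁ at-c₂ false = has-antenna (embedding (# 0 ∷ # 5 ∷ # 1 ∷ # 6 ∷ # 2 ∷ # 4 ∷ []))
two-vertex-extension-obstruction at-c₂ at-c₁ false = has-antenna (embedding (# 0 ∷ # 6 ∷ # 1 ∷ # 5 ∷ # 3 ∷ # 4 ∷ []))

bull⊆F₂ : Contains F₂ bull
bull⊆F₂ = embedding (# 0 ∷ # 1 ∷ # 2 ∷ # 3 ∷ # 4 ∷ [])

bull-extension⊆F₂ : ∀ a → Contains F₂ (extend bull (lookup (neighbourhood a)))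
bull-extension⊆F₂ at-c₁ = embedding (# 5 ∷ # 0 ∷ # 1 ∷ # 2 ∷ # 3 ∷ # 4 ∷ [])
bull-extension⊆F₂ at-c₂ = embedding (# 6 ∷ # 0 ∷ # 1 ∷ # 2 ∷ # 3 ∷ # 4 ∷ [])

module _ {G : Graph} (free : ForbiddenFree G) (B : Contains G bull) where

  Outside : Fin (n G) → Set
  Outside v = ∀ i → f B i ≢ v

  outside-attachment : ∀ v → Outside v →
    ∃ λ a → ∀ i → adj G v (f B i) ≡ lookup (neighbourhood a) i
  outside-attachment v v∉ with bull-extension-obstruction (tabulate λ i → adj G v (f B i))
  ... | inj₁ (a , eq) = a , tabulate≡⇒≗lookup eq
  ... | inj₂ obstruction = ⊥-elim (obstruction-absurd free
          (extend-embedding B v v∉ (tabulate≡⇒≗lookup refl)) obstruction)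

  bull-with : ∀ {v} (v∉ : Outside v) →
    InducedEmbedding (extend bull (lookup (neighbourhood (proj₁ (outside-attachment v v∉))))) G
  bull-with {v} v∉ = extend-embedding B v v∉ (proj₂ (outside-attachment v v∉))

  outside-bull-with : ∀ {v w} (v∉ : Outside v) → Outside w → w ≢ v →
    ∀ x → f (bull-with v∉) x ≢ w
  outside-bull-with v∉ w∉ w≢v zero    = λ v≡w → w≢v (sym v≡w)
  outside-bull-with v∉ w∉ w≢v (suc i) = w∉ i

  at-most-one-outside : ∀ {v w} → Outside v → Outside w → w ≡ v
  at-most-one-outside {v} {w} v∉ w∉ with w ≟ v
  ... | yes w≡v = w≡v
  ... | no w≢v with outside-attachment w w∉ | adj G w v in wv
  ...   | a′ , nbhdʷ | adjacent = ⊥-elim (obstruction-absurd free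
            (extend-embedding (bull-with v∉) w (outside-bull-with v∉ w∉ w≢v) nbhd)
            (two-vertex-extension-obstruction (proj₁ (outside-attachment v v∉)) a′ adjacent))
    where
    nbhd : ∀ x → adj G w (f (bull-with v∉) x) ≡ lookup (adjacent ∷ neighbourhood a′) x
    nbhd zero    = wv
    nbhd (suc i) = nbhdʷ i

  bull-with-surjective : ∀ {v} (v∉ : Outside v) w → ∃ λ x → f (bull-with v∉) x ≡ w
  bull-with-surjective v∉ w with any? (λ i → f B i ≟ w)
  ... | yes (i , bi≡w) = suc i , bi≡w
  ... | no w∉ = zero , sym (at-most-one-outside v∉ (λ i bi≡w → w∉ (i , bi≡w)))

  embeds-in-F₂ : Contains F₂ G
  embeds-in-F₂ with all? (λ w → any? (λ i → f B i ≟ w))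
  ... | yes onto = contains-trans bull⊆F₂ (surjective-embedding-inverse B onto)
  ... | no ¬onto with ¬∀⟶∃¬ _ _ (λ w → any? (λ i → f B i ≟ w)) ¬onto
  ...   | v , v∉ = contains-trans (bull-extension⊆F₂ (proj₁ (outside-attachment v outside)))
            (surjective-embedding-inverse (bull-with outside) (bull-with-surjective outside))
    where
    outside : Outside v
    outside i bi≡v = v∉ (i , bi≡v)

mainTheorem6 : (G : Graph) →
    Free G claw → Free G coClaw →
    Free G net → Free G sun3 → Free G antenna →
    Contains G bull →
    Contains F₂ G
mainTheorem6 G clawFree coClawFree netFree sun3Free antennaFree B =
  embeds-in-F₂ (record
    { claw-free = clawFree ; coClaw-free = coClawFree ; net-free = netFree
    ; sun3-free = sun3Free ; antenna-free = antennaFree }) B
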